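{- Let $\Sigma$ be a finite nonempty alphabet and let $x_1, x_2, \ldots, x_k \in \Sigma^+$ be nonempty words. Then $L = x_1^* x_2^* \cdots x_k^*$ is co-finite (i.e. $\Sigma^* \setminus L$ is finite) if and only if $|\Sigma| = 1$ and $\gcd(|x_1|, \ldots, |x_k|) = 1$. -}

module Defs where

open import Data.Nat using (ℕ; zero; suc)
open import Data.Nat.GCD using (gcd)
open import Data.List using (List; []; _∷_; _++_; concat; length; replicate; map; foldr)
open import Data.List.Membership.Propositional using (_∈_)
open import Data.Product using (Σ; ∃; _×_)
open import Relation.Nullary using (¬_)
open import Relation.Binary.PropositionalEquality using (_≡_)

Word : Set → Set
Word A = List A

NonEmptyWord : {A : Set} → Word A → Set
NonEmptyWord w = ¬ (w ≡ [])

pow : {A : Set} → Word A → ℕ → Word A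
pow x e = concat (replicate e x)

InStarProduct : {A : Set} → List (Word A) → Word A → Set
InStarProduct []       w = w ≡ []
InStarProduct {A} (x ∷ xs) w =
  Σ ℕ λ e → Σ (Word A) λ v → (w ≡ pow x e ++ v) × InStarProduct xs v

CoFinite : {A : Set} → (Word A → Set) → Set
CoFinite {A} L = Σ (List (Word A)) λ F → (w : Word A) → ¬ L w → w ∈ F

-- gcd of a list of naturals (gcd of the empty list is 0).
gcdList : List ℕ → ℕ
gcdList = foldr gcd 0

-- Every word of x₁* ⋯ xₖ* has length a combination Σ eᵢ|xᵢ| with eᵢ ∈ ℕ, hence a
-- multiple of g = gcd |xᵢ|; a co-finite language contains words of two consecutive
-- lengths, forcing g = 1. If the alphabet has two letters a ≠ b and every |xᵢ| ≤ P,
-- then in (b aᴾ)ᴿ any two b's are more than P apart, so each factor xᵢ^eᵢ covers at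
-- most one b and R ≤ k; these arbitrarily long words are missing from L.
-- Conversely, over a one-letter alphabet a word lies in L iff its length is such a
-- combination, and when g = 1 every large enough number is one (Bézout plus
-- induction on k), so only finitely many words are missing.
module Submission where

open import Defs
open import Data.Empty using (⊥-elim)
open import Data.Fin using (Fin; zero; suc)
open import Data.List using (List; []; _∷_; _++_; length; replicate; map; upTo)
open import Data.List.Membership.Propositional using (_∈_)
open import Data.List.Membership.Propositional.Properties using (∈-map⁺; ∈-upTo⁺)
open import Data.List.Properties using (length-++; length-replicate; ++-assoc; ∷-injective)
open import Data.List.Relation.Unary.All as All using (All; []; _∷_)
open import Data.List.Relation.Unary.Any using (here; there)
open import Data.Nat using (ℕ; zero; suc; _+_; _*_; _∸_; _≤_; _<_; z≤n; s≤s; _%_; _/_; _<?_; _≟_; NonZero)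
open import Data.Nat.DivMod using (m≡m%n+[m/n]*n; m%n<n)
open import Data.Nat.Divisibility
open import Data.Nat.GCD using (gcd; gcd-GCD; gcd[m,n]∣m; gcd[m,n]∣n; gcd-identityʳ; module Bézout)
open import Data.Nat.ListAction using (sum)
open import Data.Nat.Properties
open import Data.Nat.Tactic.RingSolver using (solve-∀)
open import Data.Product using (∃-syntax; ∃₂; _×_; _,_; proj₁; proj₂; map₁)
open import Function.Bundles using (_⇔_; mk⇔)
open import Relation.Nullary using (¬_; yes; no)
open import Relation.Binary.PropositionalEquality

Combination : List ℕ → ℕ → Set
Combination []       n = n ≡ 0
Combination (l ∷ ls) n = ∃₂ λ e s → n ≡ e * l + s × Combination ls s

combination-zero : ∀ ls → Combination ls 0
combination-zero []       = refl
combination-zero (l ∷ ls) = 0 , 0 , refl , combination-zero ls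

gcdList∣combination : ∀ ls {n} → Combination ls n → gcdList ls ∣ n
gcdList∣combination []       refl = 0 ∣0
gcdList∣combination (l ∷ ls) (e , s , refl , comb) =
  ∣m∣n⇒∣m+n (∣n⇒∣m*n e (gcd[m,n]∣m l _))
            (∣-trans (gcd[m,n]∣n l _) (gcdList∣combination ls comb))

bézout-mod : ∀ l g .{{_ : NonZero g}} → ∃[ c ] g ∣ gcd l g + c * l
bézout-mod l g with Bézout.identity (gcd-GCD l g)
... | Bézout.-+ x y eq = x , divides y eq
bézout-mod l g@(suc g₀) | Bézout.+- x y eq = g₀ * x , divides (d + g₀ * y) (begin
    d + g₀ * x * l       ≡⟨ cong (d +_) (trans (*-assoc g₀ x l) (cong (g₀ *_) (sym eq))) ⟩
    d + g₀ * (d + y * g) ≡⟨ regroup d g₀ y ⟩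
    (d + g₀ * y) * g     ∎)
  where
    open ≡-Reasoning
    d = gcd l g
    regroup : ∀ d g₀ y → d + g₀ * (d + y * suc g₀) ≡ (d + g₀ * y) * suc g₀
    regroup = solve-∀

-- The witness is e = g ∸ (c mod g), for which n ∸ e·l ≡ n + c·l (mod g).
peel-multiple : ∀ {g n} c l .{{_ : NonZero g}} → g ∣ n + c * l → g * l ≤ n →
                ∃₂ λ e s → e ≤ g × s + e * l ≡ n × g ∣ s
peel-multiple {g} {n} c l g∣n+cl gl≤n = e , s , m∸n≤m g r , s+el≡n , g∣s
  where
    open ≡-Reasoning
    r = c % g
    q = c / g
    e = g ∸ r
    s = n ∸ e * l
    s+el≡n : s + e * l ≡ n
    s+el≡n = m∸n+n≡m (≤-trans (*-monoˡ-≤ l (m∸n≤m g r)) gl≤n)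
    split-c : ∀ n r q g l → n + (r + q * g) * l ≡ q * l * g + (n + r * l)
    split-c = solve-∀
    g∣n+rl : g ∣ n + r * l
    g∣n+rl = ∣m+n∣m⇒∣n
      (subst (g ∣_) (trans (cong (λ k → n + k * l) (m≡m%n+[m/n]*n c g)) (split-c n r q g l)) g∣n+cl)
      (n∣m*n (q * l))
    gl+s≡n+rl : g * l + s ≡ n + r * l
    gl+s≡n+rl = begin
      g * l + s           ≡⟨ cong (λ k → k * l + s) (sym (m∸n+n≡m (<⇒≤ (m%n<n c g)))) ⟩
      (e + r) * l + s     ≡⟨ regroup e r l s ⟩
      (s + e * l) + r * l ≡⟨ cong (_+ r * l) s+el≡n ⟩
      n + r * l           ∎
      where
        regroup : ∀ e r l s → (e + r) * l + s ≡ (s + e * l) + r * l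
        regroup = solve-∀
    g∣s : g ∣ s
    g∣s = ∣m+n∣m⇒∣n (subst (g ∣_) (sym gl+s≡n+rl) g∣n+rl) (m∣m*n l)

eventually-combination : ∀ ls → ∃[ B ] ∀ n → B ≤ n → gcdList ls ∣ n → Combination ls n
eventually-combination []       = 0 , λ _ _ → 0∣⇒≡0
eventually-combination (l ∷ ls) = extend (gcdList ls) (eventually-combination ls)
  where
    extend : ∀ g → ∃[ B ] (∀ n → B ≤ n → g ∣ n → Combination ls n) →
             ∃[ B ] ∀ n → B ≤ n → gcd l g ∣ n → Combination (l ∷ ls) n
    extend zero _ = 0 , λ n _ l∣n → case-l∣n (subst (_∣ n) (gcd-identityʳ l) l∣n)
      where
        case-l∣n : ∀ {n} → l ∣ n → Combination (l ∷ ls) n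
        case-l∣n (divides t refl) = t , 0 , sym (+-identityʳ _) , combination-zero ls
    extend g@(suc _) (B , comb) = B + g * l , representable
      where
        distribute : ∀ t c {n} → n ≡ t * gcd l g → t * (gcd l g + c * l) ≡ n + t * c * l
        distribute t c refl = distribute′ t (gcd l g) c l
          where
            distribute′ : ∀ t d c l → t * (d + c * l) ≡ t * d + t * c * l
            distribute′ = solve-∀
        representable : ∀ n → B + g * l ≤ n → gcd l g ∣ n → Combination (l ∷ ls) n
        representable n B+gl≤n (divides t n≡td) with bézout-mod l g
        ... | c , g∣d+cl
          with peel-multiple (t * c) l (subst (g ∣_) (distribute t c n≡td) (∣n⇒∣m*n t g∣d+cl))
                                       (≤-trans (m≤n+m (g * l) B) B+gl≤n)
        ... | e , s , e≤g , s+el≡n , g∣s =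
          e , s , trans (sym s+el≡n) (+-comm s (e * l)) , comb s B≤s g∣s
          where
            B≤s : B ≤ s
            B≤s = +-cancelʳ-≤ (e * l) B s (begin
              B + e * l ≤⟨ +-monoʳ-≤ B (*-monoˡ-≤ l e≤g) ⟩
              B + g * l ≤⟨ B+gl≤n ⟩
              n         ≡⟨ s+el≡n ⟨
              s + e * l ∎)
              where open ≤-Reasoning

length-pow : ∀ {A : Set} (x : Word A) e → length (pow x e) ≡ e * length x
length-pow x zero    = refl
length-pow x (suc e) = trans (length-++ x) (cong (length x +_) (length-pow x e))

star-product⇒combination : ∀ {A : Set} (xs : List (Word A)) {w} →
                           InStarProduct xs w → Combination (map length xs) (length w)
star-product⇒combination []       refl = refl
star-product⇒combination (x ∷ xs) (e , v , refl , v∈L) =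
  e , length v , trans (length-++ (pow x e)) (cong (_+ length v) (length-pow x e)) ,
  star-product⇒combination xs v∈L

unary-≡ : {u v : Word (Fin 1)} → length u ≡ length v → u ≡ v
unary-≡ {[]}       {[]}       _       = refl
unary-≡ {zero ∷ u} {zero ∷ v} |u|≡|v| = cong (zero ∷_) (unary-≡ (suc-injective |u|≡|v|))

combination⇒star-product : ∀ (xs : List (Word (Fin 1))) w →
                           Combination (map length xs) (length w) → InStarProduct xs w
combination⇒star-product []       []      _ = refl
combination⇒star-product (x ∷ xs) w (e , s , |w|≡ , comb) =
  e , replicate s zero ,
  unary-≡ (trans |w|≡ (sym (trans (length-++ (pow x e))
                                  (cong₂ _+_ (length-pow x e) (length-replicate s))))) ,
  combination⇒star-product xs (replicate s zero) (subst (Combination _) (sym (length-replicate s)) comb)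

∈⇒≤sum : ∀ {n ns} → n ∈ ns → n ≤ sum ns
∈⇒≤sum (here refl)  = m≤m+n _ _
∈⇒≤sum (there n∈ns) = ≤-trans (∈⇒≤sum n∈ns) (m≤n+m _ _)

cofinite⇒long-words : ∀ {A : Set} {L : Word A → Set} → CoFinite L →
                      ∃[ N ] ∀ w → N < length w → ¬ ¬ L w
cofinite⇒long-words (F , ∁L⊆F) =
  sum (map length F) , λ w N<|w| w∉L → <⇒≱ N<|w| (∈⇒≤sum (∈-map⁺ length (∁L⊆F w w∉L)))

long-words⇒cofinite : ∀ B {L : Word (Fin 1) → Set} → (∀ w → B ≤ length w → L w) → CoFinite L
long-words⇒cofinite B {L} long = map (λ n → replicate n zero) (upTo B) , ∁L⊆short
  where
    ∁L⊆short : ∀ w → ¬ L w → w ∈ map (λ n → replicate n zero) (upTo B)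
    ∁L⊆short w w∉L with length w <? B
    ... | yes |w|<B = subst (_∈ _) (unary-≡ (length-replicate (length w))) (∈-map⁺ _ (∈-upTo⁺ |w|<B))
    ... | no  |w|≮B = ⊥-elim (w∉L (long w (≮⇒≥ |w|≮B)))

cofinite⇒gcd≡1 : ∀ {A : Set} (z : A) {L : Word A → Set} g →
                 (∀ w → L w → g ∣ length w) → CoFinite L → g ≡ 1
cofinite⇒gcd≡1 z {L} g ∣length cf with cofinite⇒long-words cf | g ≟ 1
... | _        | yes g≡1 = g≡1
... | N , long | no  g≢1 = ⊥-elim (
  long-zᵏ (suc N) ≤-refl      λ zᴺ⁺¹∈L →
  long-zᵏ (2 + N) (n≤1+n _)   λ zᴺ⁺²∈L →
  g≢1 (∣1⇒≡1 (∣m+n∣m⇒∣n (subst (g ∣_) (+-comm 1 (suc N)) (g∣k zᴺ⁺²∈L)) (g∣k zᴺ⁺¹∈L))))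
  where
    long-zᵏ : ∀ k → N < k → ¬ ¬ L (replicate k z)
    long-zᵏ k N<k = long (replicate k z) (≤-trans N<k (≤-reflexive (sym (length-replicate k))))
    g∣k : ∀ {k} → L (replicate k z) → g ∣ k
    g∣k {k} zᵏ∈L = subst (g ∣_) (length-replicate k) (∣length (replicate k z) zᵏ∈L)

module TwoLetters {A : Set} (a b : A) (a≢b : ¬ a ≡ b) (P : ℕ) where

  block : Word A
  block = b ∷ replicate P a

  -- The suffixes of blockᴿ are the words aʲ blockᴿ′ with j ≤ P.
  Suffix : ℕ → ℕ → Word A
  Suffix j R = replicate j a ++ pow block R

  prefix-of-aⁿ : ∀ x v T n → length x ≤ n → x ++ v ≡ replicate n a ++ T →
                 x ≡ replicate (length x) a × v ≡ replicate (n ∸ length x) a ++ T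
  prefix-of-aⁿ []      v T n       _         eq = refl , eq
  prefix-of-aⁿ (c ∷ x) v T (suc n) (s≤s |x|≤n) eq with ∷-injective eq
  ... | refl , eq′ = map₁ (cong (a ∷_)) (prefix-of-aⁿ x v T n |x|≤n eq′)

  aʲb≢aᵏ : ∀ {j k} r T → j < k → ¬ replicate j a ++ b ∷ r ≡ replicate k a ++ T
  aʲb≢aᵏ {zero}  {suc k} r T _           eq = a≢b (sym (proj₁ (∷-injective eq)))
  aʲb≢aᵏ {suc j} {suc k} r T (s≤s j<k) eq = aʲb≢aᵏ r T j<k (proj₂ (∷-injective eq))

  data FrontSplit (x v : Word A) (j R : ℕ) : Set where
    a-only    : ∀ j′ → v ≡ Suffix j′ R → FrontSplit x v j R
    through-b : ∀ i R′ → R ≡ suc R′ → x ≡ replicate j a ++ b ∷ replicate i a →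
                v ≡ Suffix (P ∸ i) R′ → FrontSplit x v j R

  front-split : ∀ x v j R → length x ≤ P → x ++ v ≡ Suffix j R → FrontSplit x v j R
  front-split []      v j       R       _ eq = a-only j eq
  front-split (c ∷ x) v zero    zero    _ ()
  front-split (c ∷ x) v zero    (suc R) |x|<P eq with ∷-injective eq
  ... | refl , eq′ with prefix-of-aⁿ x v (pow block R) P (<⇒≤ |x|<P) eq′
  ... | x≡aⁱ , v≡ = through-b (length x) R refl (cong (b ∷_) x≡aⁱ) v≡
  front-split (c ∷ x) v (suc j) R       |x|<P eq with ∷-injective eq
  ... | refl , eq′ with front-split x v j R (<⇒≤ |x|<P) eq′
  ... | a-only j′ v≡                 = a-only j′ v≡
  ... | through-b i R′ R≡ x≡aʲbaⁱ v≡ = through-b i R′ R≡ (cong (a ∷_) x≡aʲbaⁱ) v≡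

  -- A second copy of x = aʲ b aⁱ would need its b within the P ∸ i letters a that
  -- follow the first b, which |x| ≤ P forbids.
  pow-consumes-one-block : ∀ x → length x ≤ P → ∀ e v j R → pow x e ++ v ≡ Suffix j R →
                           ∃₂ λ j′ R′ → v ≡ Suffix j′ R′ × R ≤ suc R′
  pow-consumes-one-block x _    zero    v j R eq = j , R , eq , n≤1+n R
  pow-consumes-one-block x |x|≤P (suc e) v j R eq
    with front-split x (pow x e ++ v) j R |x|≤P (trans (sym (++-assoc x (pow x e) v)) eq)
  ... | a-only j′ rest≡ = pow-consumes-one-block x |x|≤P e v j′ R rest≡
  ... | through-b i R′ refl x≡ rest≡ with e
  ...   | zero   = P ∸ i , R′ , rest≡ , ≤-refl
  ...   | suc e′ = ⊥-elim (aʲb≢aᵏ (replicate i a ++ pow x e′ ++ v) (pow block R′) j<P∸i (begin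
          replicate j a ++ b ∷ replicate i a ++ pow x e′ ++ v   ≡⟨ ++-assoc (replicate j a) _ _ ⟨
          (replicate j a ++ b ∷ replicate i a) ++ pow x e′ ++ v ≡⟨ cong (_++ pow x e′ ++ v) x≡ ⟨
          x ++ pow x e′ ++ v                                    ≡⟨ ++-assoc x (pow x e′) v ⟨
          pow x (suc e′) ++ v                                   ≡⟨ rest≡ ⟩
          Suffix (P ∸ i) R′                                     ∎))
    where
      open ≡-Reasoning
      |x|≡ : length x ≡ suc (j + i)
      |x|≡ = begin
        length x                                              ≡⟨ cong length x≡ ⟩
        length (replicate j a ++ b ∷ replicate i a)           ≡⟨ length-++ (replicate j a) ⟩
        length (replicate j a) + suc (length (replicate i a)) ≡⟨ cong₂ (λ m n → m + suc n)
                                                                   (length-replicate j) (length-replicate i) ⟩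
        j + suc i                                             ≡⟨ +-suc j i ⟩
        suc (j + i)                                           ∎
      j<P∸i : j < P ∸ i
      j<P∸i = m+n≤o⇒m≤o∸n (suc j) (≤-trans (≤-reflexive (sym |x|≡)) |x|≤P)

  blocks≤length : ∀ xs → All (λ x → length x ≤ P) xs → ∀ j R →
                  InStarProduct xs (Suffix j R) → R ≤ length xs
  blocks≤length []       _ j zero    _  = z≤n
  blocks≤length []       _ zero    (suc R) ()
  blocks≤length []       _ (suc j) (suc R) ()
  blocks≤length (x ∷ xs) (|x|≤P ∷ bounds) j R (e , v , w≡ , v∈L)
    with pow-consumes-one-block x |x|≤P e v j R (sym w≡)
  ... | j′ , R′ , refl , R≤1+R′ = ≤-trans R≤1+R′ (s≤s (blocks≤length xs bounds j′ R′ v∈L))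

  R≤|blockᴿ| : ∀ R → R ≤ length (pow block R)
  R≤|blockᴿ| R = ≤-trans (m≤m*n R (length block)) (≤-reflexive (sym (length-pow block R)))

cofinite⇒unary : ∀ m (xs : List (Word (Fin (suc m)))) → CoFinite (InStarProduct xs) → suc m ≡ 1
cofinite⇒unary zero    _  _  = refl
cofinite⇒unary (suc m) xs cf with cofinite⇒long-words cf
... | N , long = ⊥-elim (long (pow block R) N<|w| λ w∈L →
                   <⇒≱ (s≤s (m≤m+n (length xs) N)) (blocks≤length xs bounds 0 R w∈L))
  where
    open TwoLetters {Fin (2 + m)} zero (suc zero) (λ ()) (sum (map length xs))
    R = suc (length xs + N)
    N<|w| : N < length (pow block R)
    N<|w| = ≤-trans (s≤s (m≤n+m N (length xs))) (R≤|blockᴿ| R)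
    bounds : All (λ x → length x ≤ sum (map length xs)) xs
    bounds = All.tabulate (λ x∈xs → ∈⇒≤sum (∈-map⁺ length x∈xs))

-- The words need not be nonempty: an empty xᵢ adds nothing to L and 0 to the gcd.
theorem5 : (m : ℕ) (xs : List (Word (Fin (suc m)))) → All NonEmptyWord xs →
    CoFinite (InStarProduct xs) ⇔ (suc m ≡ 1 × gcdList (map length xs) ≡ 1)
theorem5 m xs _ = mk⇔ necessary sufficient
  where
    necessary : CoFinite (InStarProduct xs) → suc m ≡ 1 × gcdList (map length xs) ≡ 1
    necessary cf =
      cofinite⇒unary m xs cf ,
      cofinite⇒gcd≡1 zero _ (λ w w∈L → gcdList∣combination _ (star-product⇒combination xs w∈L)) cf
    sufficient : suc m ≡ 1 × gcdList (map length xs) ≡ 1 → CoFinite (InStarProduct xs)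
    sufficient (refl , gcd≡1) with eventually-combination (map length xs)
    ... | B , comb = long-words⇒cofinite B λ w B≤|w| →
      combination⇒star-product xs w (comb (length w) B≤|w| (subst (_∣ length w) (sym gcd≡1) (1∣ length w)))
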